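{- Let $n\ge 1$ and $0\le k\le n-1$ be integers and define $f_k\colon\{0,1\}^n\to\{0,1,\perp\}$ by $f_k(x)=0$ if $|x|\le k$, $f_k(x)=\perp$ if $k+1\le |x|\le n-1$, and $f_k(x)=1$ if $|x|=n$. Then $\mathrm{NADT^{\oplus}}(f_k)=\mathrm{DT^{\oplus}}(f_k)=k+1$.
   Context: $|x|$ denotes the Hamming weight of $x$. For a partial function $f$, $\operatorname{Dom}(f)=f^{ -1}(\{0,1\})$. For $s,x\in\{0,1\}^n$ let $\langle s,x\rangle=\bigoplus_i s_i\wedge x_i$. A (adaptive) parity decision tree computing $f$ is a decision tree in which each internal node queries $\langle s,x\rangle$ for some $s\in\{0,1\}^n$ and branches on the answer, and whose leaves are labelled by outputs, such that on every $x\in\operatorname{Dom}(f)$ the reached leaf outputs $f(x)$; $\mathrm{DT^{\oplus}}(f)$ is the minimum depth (worst-case number of queries) of such a tree. A non-adaptive parity decision tree of cost $p$ for $f$ consists of vectors $s_1,\dots,s_p\in\{0,1\}^n$ and a total function $l\colon\{0,1\}^p\to\{0,1\}$ with $l(\langle s_1,x\rangle,\dots,\langle s_p,x\rangle)=f(x)$ for all $x\in\operatorname{Dom}(f)$; $\mathrm{NADT^{\oplus}}(f)$ is the minimum such $p$. -}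

module Defs where

open import Data.Nat using (ℕ; zero; suc; _≤_; _≤?_; _≟_)
open import Data.Bool using (Bool; true; false; _∧_; _xor_; if_then_else_)
open import Data.Maybe using (Maybe; just; nothing)
open import Data.Vec using (Vec; []; _∷_; map)
open import Data.Product using (Σ; _×_; _,_)
open import Relation.Binary.PropositionalEquality using (_≡_)
open import Relation.Nullary.Decidable using (⌊_⌋)

weight : ∀ {n} → Vec Bool n → ℕ
weight []          = zero
weight (true ∷ x)  = suc (weight x)
weight (false ∷ x) = weight x

inner : ∀ {n} → Vec Bool n → Vec Bool n → Bool
inner []       []       = false
inner (s ∷ ss) (x ∷ xs) = (s ∧ x) xor inner ss xs

-- partial Boolean functions on {0,1}^n ; nothing = ⊥ (outside Dom f)
PFun : ℕ → Set
PFun n = Vec Bool n → Maybe Bool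

fk : (n k : ℕ) → PFun n
fk n k x =
  if ⌊ weight x ≤? k ⌋ then just false
  else (if ⌊ weight x ≟ n ⌋ then just true else nothing)

data PDT (n : ℕ) : Set where
  leaf : Bool → PDT n
  node : Vec Bool n → PDT n → PDT n → PDT n

eval : ∀ {n} → PDT n → Vec Bool n → Bool
eval (leaf b)       x = b
eval (node s t₀ t₁) x = if inner s x then eval t₁ x else eval t₀ x

depth : ∀ {n} → PDT n → ℕ
depth (leaf _)       = zero
depth (node _ t₀ t₁) = suc (depth t₀ Data.Nat.⊔ depth t₁)

PDTComputes : ∀ {n} → PDT n → PFun n → Set
PDTComputes t f = ∀ x b → f x ≡ just b → eval t x ≡ b

DTParityIs : ∀ {n} → PFun n → ℕ → Set
DTParityIs {n} f d =
  Σ (PDT n) (λ t → PDTComputes t f × depth t ≡ d)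
  × (∀ (t : PDT n) → PDTComputes t f → d ≤ depth t)

record NAPDT (n p : ℕ) : Set where
  constructor napdt
  field
    queries : Vec (Vec Bool n) p
    label   : Vec Bool p → Bool

NAPDTComputes : ∀ {n p} → NAPDT n p → PFun n → Set
NAPDTComputes (napdt qs l) f =
  ∀ x b → f x ≡ just b → l (map (λ s → inner s x) qs) ≡ b

NADTParityIs : ∀ {n} → PFun n → ℕ → Set
NADTParityIs {n} f p =
  Σ (NAPDT n p) (λ T → NAPDTComputes T f)
  × (∀ (q : ℕ) (T : NAPDT n q) → NAPDTComputes T f → p ≤ q)

-- A parity decision tree of depth d reaches the same leaf on every input satisfying
-- the d linear equations read along the path of 1ⁿ, and Gaussian elimination shows that
-- a consistent system of d equations over 𝔽₂ has a solution of Hamming weight at most d.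
-- So a tree of depth ≤ k cannot separate 1ⁿ from every input of weight ≤ k; the same holds
-- for non-adaptive trees, which unfold into adaptive ones of the same depth. Conversely,
-- querying the first k + 1 coordinates and returning their conjunction computes f_k.
module Submission where

open import Defs
open import Algebra using (CommutativeRing)
open import Data.Bool using (Bool; true; false; _∧_; _xor_; if_then_else_)
open import Data.Bool.Properties
  using (xor-∧-commutativeRing; xor-assoc; xor-same; xor-identityʳ; ∧-distribʳ-xor)
open import Data.Bool.ListAction using (and)
open import Data.List using (List; []; _∷_; length)
open import Data.List.Relation.Unary.All using (All; []; _∷_)
open import Data.Maybe using (Maybe; just; nothing)
open import Data.Nat using (ℕ; zero; suc; _≤_; _<_; _⊔_; z≤n; s≤s; _≤?_; _≟_)
open import Data.Nat.Properties
  using (≤-trans; ≤-reflexive; ≰⇒>; <⇒≱; suc-injective; 1+n≰n; m≤n⇒m≤1+n; m≤m⊔n; m≤n⊔m; ⊔-idem)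
open import Data.Product using (∃-syntax; _×_; _,_; proj₂)
open import Data.Unit using (⊤; tt)
open import Data.Empty using (⊥-elim)
open import Data.Vec using (Vec; []; _∷_; map; replicate; zipWith; toList)
open import Data.Vec.Properties using (map-∘)
open import Relation.Nullary using (yes; no)
open import Relation.Binary.PropositionalEquality
  using (_≡_; _≢_; refl; sym; trans; cong; cong₂; subst; module ≡-Reasoning)

open CommutativeRing xor-∧-commutativeRing using (+-commutativeSemigroup)
open import Algebra.Properties.CommutativeSemigroup +-commutativeSemigroup
  using () renaming (interchange to xor-interchange)

open ≡-Reasoning

private
  variable
    m n p : ℕ

xor-cancelʳ : ∀ a b → (a xor b) xor b ≡ a
xor-cancelʳ a b = begin
  (a xor b) xor b   ≡⟨ xor-assoc a b b ⟩
  a xor (b xor b)   ≡⟨ cong (a xor_) (xor-same b) ⟩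
  a xor false       ≡⟨ xor-identityʳ a ⟩
  a                 ∎

xor-cancelˡ-both : ∀ a b c → (a xor b) xor (a xor c) ≡ b xor c
xor-cancelˡ-both a b c = begin
  (a xor b) xor (a xor c)   ≡⟨ xor-interchange a b a c ⟩
  (a xor a) xor (b xor c)   ≡⟨ cong (_xor (b xor c)) (xor-same a) ⟩
  b xor c                   ∎

inner-zipWith-xor : ∀ (s t x : Vec Bool n) →
  inner (zipWith _xor_ s t) x ≡ inner s x xor inner t x
inner-zipWith-xor []       []       []       = refl
inner-zipWith-xor (s ∷ ss) (t ∷ ts) (y ∷ xs) = begin
  ((s xor t) ∧ y) xor inner (zipWith _xor_ ss ts) xs
    ≡⟨ cong₂ _xor_ (∧-distribʳ-xor y s t) (inner-zipWith-xor ss ts xs) ⟩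
  ((s ∧ y) xor (t ∧ y)) xor (inner ss xs xor inner ts xs)
    ≡⟨ xor-interchange (s ∧ y) (t ∧ y) (inner ss xs) (inner ts xs) ⟩
  ((s ∧ y) xor inner ss xs) xor ((t ∧ y) xor inner ts xs)
    ∎

inner-replicate-false : ∀ (x : Vec Bool n) → inner (replicate n false) x ≡ false
inner-replicate-false []      = refl
inner-replicate-false (_ ∷ x) = inner-replicate-false x

weight-replicate-true : ∀ n → weight (replicate n true) ≡ n
weight-replicate-true zero    = refl
weight-replicate-true (suc n) = cong suc (weight-replicate-true n)

weight≤length : ∀ (x : Vec Bool n) → weight x ≤ n
weight≤length []          = z≤n
weight≤length (true ∷ x)  = s≤s (weight≤length x)
weight≤length (false ∷ x) = m≤n⇒m≤1+n (weight≤length x)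

weight≡length⇒replicate-true : ∀ (x : Vec Bool n) → weight x ≡ n → x ≡ replicate n true
weight≡length⇒replicate-true []          _ = refl
weight≡length⇒replicate-true (true ∷ x)  w = cong (true ∷_) (weight≡length⇒replicate-true x (suc-injective w))
weight≡length⇒replicate-true (false ∷ x) w = ⊥-elim (1+n≰n (subst (_≤ _) w (weight≤length x)))

Equation : ℕ → Set
Equation n = Vec Bool n × Bool

_⊨_ : Vec Bool n → Equation n → Set
x ⊨ (s , c) = inner s x ≡ c

_⊨*_ : Vec Bool n → List (Equation n) → Set
x ⊨* E = All (x ⊨_) E

-- Eliminating x₀: the pivot (s , c) stands for x₀ ⊕ ⟨s,x'⟩ = c, and every other equation
-- involving x₀ has the pivot added to it.
record Elimination (m : ℕ) : Set where
  constructor elim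
  field
    pivot  : Maybe (Equation m)
    others : List (Equation m)
open Elimination

size : Elimination m → ℕ
size (elim nothing  E) = length E
size (elim (just _) E) = suc (length E)

PivotHolds : Bool → Vec Bool m → Maybe (Equation m) → Set
PivotHolds x₀ x' nothing        = ⊤
PivotHolds x₀ x' (just (s , c)) = x₀ xor inner s x' ≡ c

Eliminated : Bool → Vec Bool m → Elimination m → Set
Eliminated x₀ x' (elim p E) = PivotHolds x₀ x' p × x' ⊨* E

absorb : Equation (suc m) → Elimination m → Elimination m
absorb (false ∷ s , c) (elim p E)                  = elim p ((s , c) ∷ E)
absorb (true ∷ s , c)  (elim nothing E)            = elim (just (s , c)) E
absorb (true ∷ s , c)  (elim (just (s₀ , c₀)) E) =
  elim (just (s₀ , c₀)) ((zipWith _xor_ s s₀ , c xor c₀) ∷ E)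

eliminate : List (Equation (suc m)) → Elimination m
eliminate []      = elim nothing []
eliminate (e ∷ E) = absorb e (eliminate E)

size-absorb : ∀ (e : Equation (suc m)) r → size (absorb e r) ≡ suc (size r)
size-absorb (false ∷ s , c) (elim nothing  E) = refl
size-absorb (false ∷ s , c) (elim (just _) E) = refl
size-absorb (true ∷ s , c)  (elim nothing  E) = refl
size-absorb (true ∷ s , c)  (elim (just _) E) = refl

size-eliminate : ∀ (E : List (Equation (suc m))) → size (eliminate E) ≡ length E
size-eliminate []      = refl
size-eliminate (e ∷ E) = trans (size-absorb e (eliminate E)) (cong suc (size-eliminate E))

absorb-sound : ∀ (e : Equation (suc m)) r {x₀ x'} →
  (x₀ ∷ x') ⊨ e → Eliminated x₀ x' r → Eliminated x₀ x' (absorb e r)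
absorb-sound (false ∷ s , c) (elim p E) h (hp , hE) = hp , h ∷ hE
absorb-sound (true ∷ s , c)  (elim nothing E) h (_ , hE) = h , hE
absorb-sound (true ∷ s , c)  (elim (just (s₀ , c₀)) E) {x₀} {x'} h (hp , hE) = hp , combined ∷ hE
  where
  combined : x' ⊨ (zipWith _xor_ s s₀ , c xor c₀)
  combined = begin
    inner (zipWith _xor_ s s₀) x'              ≡⟨ inner-zipWith-xor s s₀ x' ⟩
    inner s x' xor inner s₀ x'                 ≡⟨ xor-cancelˡ-both x₀ _ _ ⟨
    (x₀ xor inner s x') xor (x₀ xor inner s₀ x') ≡⟨ cong₂ _xor_ h hp ⟩
    c xor c₀                                   ∎

absorb-complete : ∀ (e : Equation (suc m)) r {x₀ x'} →
  Eliminated x₀ x' (absorb e r) → (x₀ ∷ x') ⊨ e × Eliminated x₀ x' r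
absorb-complete (false ∷ s , c) (elim p E) (hp , h ∷ hE) = h , hp , hE
absorb-complete (true ∷ s , c)  (elim nothing E) (h , hE) = h , tt , hE
absorb-complete (true ∷ s , c)  (elim (just (s₀ , c₀)) E) {x₀} {x'} (hp , h ∷ hE) = combined , hp , hE
  where
  combined : x₀ xor inner s x' ≡ c
  combined = begin
    x₀ xor inner s x'
      ≡⟨ xor-cancelʳ _ (x₀ xor inner s₀ x') ⟨
    ((x₀ xor inner s x') xor (x₀ xor inner s₀ x')) xor (x₀ xor inner s₀ x')
      ≡⟨ cong₂ _xor_ (trans (xor-cancelˡ-both x₀ _ _) (trans (sym (inner-zipWith-xor s s₀ x')) h)) hp ⟩
    (c xor c₀) xor c₀
      ≡⟨ xor-cancelʳ c c₀ ⟩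
    c ∎

eliminate-sound : ∀ (E : List (Equation (suc m))) {x₀ x'} →
  (x₀ ∷ x') ⊨* E → Eliminated x₀ x' (eliminate E)
eliminate-sound []      []       = tt , []
eliminate-sound (e ∷ E) (h ∷ hE) = absorb-sound e (eliminate E) h (eliminate-sound E hE)

eliminate-complete : ∀ (E : List (Equation (suc m))) {x₀ x'} →
  Eliminated x₀ x' (eliminate E) → (x₀ ∷ x') ⊨* E
eliminate-complete []      _ = []
eliminate-complete (e ∷ E) h with absorb-complete e (eliminate E) h
... | he , hE = he ∷ eliminate-complete E hE

solvePivot : Maybe (Equation m) → Vec Bool m → Bool
solvePivot nothing        x' = false
solvePivot (just (s , c)) x' = c xor inner s x'

solvePivot-holds : ∀ (p : Maybe (Equation m)) x' → PivotHolds (solvePivot p x') x' p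
solvePivot-holds nothing        x' = tt
solvePivot-holds (just (s , c)) x' = xor-cancelʳ c (inner s x')

weight-solvePivot : ∀ (r : Elimination m) x' → weight x' ≤ length (others r) →
  weight (solvePivot (pivot r) x' ∷ x') ≤ size r
weight-solvePivot (elim nothing E) x' w = w
weight-solvePivot (elim (just (s , c)) E) x' w with c xor inner s x'
... | true  = s≤s w
... | false = m≤n⇒m≤1+n w

∃-solution-weight≤length : ∀ (E : List (Equation n)) {a} → a ⊨* E →
  ∃[ x ] x ⊨* E × weight x ≤ length E
∃-solution-weight≤length E {[]}     a⊨E = [] , a⊨E , z≤n
∃-solution-weight≤length E {_ ∷ a'} a⊨E =
  extend (∃-solution-weight≤length (others r) (proj₂ (eliminate-sound E a⊨E)))
  where
  r = eliminate E
  extend : ∃[ x' ] x' ⊨* others r × weight x' ≤ length (others r) →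
           ∃[ x ] x ⊨* E × weight x ≤ length E
  extend (x' , x'⊨ , w) =
    solvePivot (pivot r) x' ∷ x' ,
    eliminate-complete E (solvePivot-holds (pivot r) x' , x'⊨) ,
    ≤-trans (weight-solvePivot r x' w) (≤-reflexive (size-eliminate E))

path : PDT n → Vec Bool n → List (Equation n)
path (leaf _)       a = []
path (node s t₀ t₁) a = (s , inner s a) ∷ (if inner s a then path t₁ a else path t₀ a)

⊨*-path : ∀ (t : PDT n) a → a ⊨* path t a
⊨*-path (leaf _)       a = []
⊨*-path (node s t₀ t₁) a with inner s a in eq
... | true  = eq ∷ ⊨*-path t₁ a
... | false = eq ∷ ⊨*-path t₀ a

length-path≤depth : ∀ (t : PDT n) a → length (path t a) ≤ depth t
length-path≤depth (leaf _)       a = z≤n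
length-path≤depth (node s t₀ t₁) a with inner s a
... | true  = s≤s (≤-trans (length-path≤depth t₁ a) (m≤n⊔m (depth t₀) (depth t₁)))
... | false = s≤s (≤-trans (length-path≤depth t₀ a) (m≤m⊔n (depth t₀) (depth t₁)))

eval-path : ∀ (t : PDT n) a {x} → x ⊨* path t a → eval t x ≡ eval t a
eval-path (leaf _)       a _ = refl
eval-path (node s t₀ t₁) a {x} (h ∷ x⊨) with inner s x | inner s a | h
... | true  | .true  | refl = eval-path t₁ a x⊨
... | false | .false | refl = eval-path t₀ a x⊨

∃-weight≤depth-eval≡ : ∀ (t : PDT n) a → ∃[ x ] weight x ≤ depth t × eval t x ≡ eval t a
∃-weight≤depth-eval≡ t a with x , x⊨ , w ← ∃-solution-weight≤length (path t a) (⊨*-path t a) =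
  x , ≤-trans w (length-path≤depth t a) , eval-path t a x⊨

unfold : Vec (Vec Bool n) p → (Vec Bool p → Bool) → PDT n
unfold []       l = leaf (l [])
unfold (s ∷ qs) l = node s (unfold qs (λ v → l (false ∷ v))) (unfold qs (λ v → l (true ∷ v)))

toPDT : NAPDT n p → PDT n
toPDT (napdt qs l) = unfold qs l

eval-unfold : ∀ (qs : Vec (Vec Bool n) p) l x → eval (unfold qs l) x ≡ l (map (λ s → inner s x) qs)
eval-unfold []       l x = refl
eval-unfold (s ∷ qs) l x with inner s x
... | true  = eval-unfold qs (λ v → l (true ∷ v)) x
... | false = eval-unfold qs (λ v → l (false ∷ v)) x

depth-unfold : ∀ (qs : Vec (Vec Bool n) p) l → depth (unfold qs l) ≡ p
depth-unfold []       l = refl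
depth-unfold (s ∷ qs) l =
  cong suc (trans (cong₂ _⊔_ (depth-unfold qs (λ v → l (false ∷ v)))
                             (depth-unfold qs (λ v → l (true ∷ v))))
                  (⊔-idem _))

toPDT-computes : ∀ (T : NAPDT n p) {f} → NAPDTComputes T f → PDTComputes (toPDT T) f
toPDT-computes (napdt qs l) T-computes x b fx≡b = trans (eval-unfold qs l x) (T-computes x b fx≡b)

depth-toPDT : ∀ (T : NAPDT n p) → depth (toPDT T) ≡ p
depth-toPDT (napdt qs l) = depth-unfold qs l

module _ {A : Set} where

  prefix : p ≤ n → Vec A n → Vec A p
  prefix z≤n     _        = []
  prefix (s≤s h) (x ∷ xs) = x ∷ prefix h xs

prefixQueries : p ≤ n → Vec (Vec Bool n) p
prefixQueries z≤n     = []
prefixQueries (s≤s h) = (true ∷ replicate _ false) ∷ map (false ∷_) (prefixQueries h)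

answers-prefixQueries : ∀ (h : p ≤ n) x → map (λ s → inner s x) (prefixQueries h) ≡ prefix h x
answers-prefixQueries z≤n     x       = refl
answers-prefixQueries (s≤s h) (b ∷ x) =
  cong₂ _∷_ (trans (cong (b xor_) (inner-replicate-false x)) (xor-identityʳ b))
            (trans (sym (map-∘ (λ s → inner s (b ∷ x)) (false ∷_) (prefixQueries h)))
                   (answers-prefixQueries h x))

and-prefix-replicate-true : ∀ (h : p ≤ n) → and (toList (prefix h (replicate n true))) ≡ true
and-prefix-replicate-true z≤n     = refl
and-prefix-replicate-true (s≤s h) = and-prefix-replicate-true h

and-prefix⇒≤weight : ∀ (h : p ≤ n) x → and (toList (prefix h x)) ≡ true → p ≤ weight x
and-prefix⇒≤weight z≤n     x           _   = z≤n
and-prefix⇒≤weight (s≤s h) (true ∷ x)  all = s≤s (and-prefix⇒≤weight h x all)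
and-prefix⇒≤weight (s≤s h) (false ∷ x) ()

conjunctionOfPrefix : p ≤ n → NAPDT n p
conjunctionOfPrefix h = napdt (prefixQueries h) (λ v → and (toList v))

module _ {n k : ℕ} where

  fk-light : ∀ x → weight x ≤ k → fk n k x ≡ just false
  fk-light x w≤k with weight x ≤? k
  ... | yes _   = refl
  ... | no w≰k = ⊥-elim (w≰k w≤k)

  fk-replicate-true : k < n → fk n k (replicate n true) ≡ just true
  fk-replicate-true k<n rewrite weight-replicate-true n with n ≤? k
  ... | yes n≤k = ⊥-elim (<⇒≱ k<n n≤k)
  ... | no _ with n ≟ n
  ...   | yes _  = refl
  ...   | no n≢n = ⊥-elim (n≢n refl)

  fk≡true⇒weight≡ : ∀ x → fk n k x ≡ just true → weight x ≡ n
  fk≡true⇒weight≡ x fx≡1 with weight x ≤? k | weight x ≟ n | fx≡1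
  ... | no _ | yes w≡n | _ = w≡n
  ... | yes _ | _ | ()
  ... | no _ | no _ | ()

  fk≡false⇒weight≤ : ∀ x → fk n k x ≡ just false → weight x ≤ k
  fk≡false⇒weight≤ x fx≡0 with weight x ≤? k | weight x ≟ n | fx≡0
  ... | yes w≤k | _ | _ = w≤k
  ... | no _ | yes _ | ()
  ... | no _ | no _ | ()

  conjunctionOfPrefix-computes : (k<n : k < n) → NAPDTComputes (conjunctionOfPrefix k<n) (fk n k)
  conjunctionOfPrefix-computes k<n x true fx≡1
    rewrite answers-prefixQueries k<n x | weight≡length⇒replicate-true x (fk≡true⇒weight≡ x fx≡1)
    = and-prefix-replicate-true k<n
  conjunctionOfPrefix-computes k<n x false fx≡0
    rewrite answers-prefixQueries k<n x with and (toList (prefix k<n x)) in all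
  ... | false = refl
  ... | true  = ⊥-elim (<⇒≱ (s≤s (fk≡false⇒weight≤ x fx≡0)) (and-prefix⇒≤weight k<n x all))

  fk-depth-lowerBound : k < n → ∀ (t : PDT n) → PDTComputes t (fk n k) → suc k ≤ depth t
  fk-depth-lowerBound k<n t t-computes = ≰⇒> λ depth≤k →
    let x , w , same = ∃-weight≤depth-eval≡ t (replicate n true) in
    false≢true (begin
      false                     ≡⟨ t-computes x false (fk-light x (≤-trans w depth≤k)) ⟨
      eval t x                  ≡⟨ same ⟩
      eval t (replicate n true) ≡⟨ t-computes (replicate n true) true (fk-replicate-true k<n) ⟩
      true                      ∎)
    where
    false≢true : false ≢ true
    false≢true ()

theorem26 : (n k : ℕ) → 1 ≤ n → k < n →
    NADTParityIs (fk n k) (suc k) × DTParityIs (fk n k) (suc k)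
theorem26 n k _ k<n =
  ( (T , conjunctionOfPrefix-computes k<n)
  , λ q T′ T′-computes → ≤-trans (fk-depth-lowerBound k<n (toPDT T′) (toPDT-computes T′ T′-computes))
                                 (≤-reflexive (depth-toPDT T′)) )
  , ( (toPDT T , toPDT-computes T (conjunctionOfPrefix-computes k<n) , depth-toPDT T)
    , fk-depth-lowerBound k<n )
  where
  T : NAPDT n (suc k)
  T = conjunctionOfPrefix k<n
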